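{- Let $k>1$ be an integer and $\sigma$ a permutation of $\{0,1,\ldots,n\}$. Every perfect $(\sigma,k)$-permutiple $[a_0;a_1,\ldots,a_n]$ is a Landess permutiple.
   Context: For positive integers $a_0,\ldots,a_n$, $[a_0;a_1,\ldots,a_n]$ denotes the finite simple continued fraction $a_0+1/(a_1+1/(\cdots+1/a_n))$; all finite continued fractions are assumed in canonical form (last digit at least $2$ when there are at least two digits). For an integer $k>1$ and a permutation $\sigma$ of $\{0,\ldots,n\}$, $r=[a_0;\ldots,a_n]$ is a $(\sigma,k)$-permutiple if $r=k\,[a_{\sigma(0)};a_{\sigma(1)},\ldots,a_{\sigma(n)}]$. It is perfect if $a_j=k\,a_{\sigma(j)}$ for every even $j$ and $a_{\sigma(j)}=k\,a_j$ for every odd $j$ ($0\le j\le n$). Continuants: $K_0()=1$, $K_1(x_0)=x_0$, $K_m(x_0,\ldots,x_{m-1})=x_{m-1}K_{m-1}(x_0,\ldots,x_{m-2})+K_{m-2}(x_0,\ldots,x_{m-3})$. Let $p_j=K_{j+1}(a_0,\ldots,a_j)$, $q_j=K_j(a_1,\ldots,a_j)$, $p'_j=K_{j+1}(a_{\sigma(0)},\ldots,a_{\sigma(j)})$, $q'_j=K_j(a_{\sigma(1)},\ldots,a_{\sigma(j)})$. The permutiple is continuant-preserving if $p_n=p'_n$, and it is a Landess permutiple if it is continuant-preserving and $q_{n-1}=q'_{n-1}$ and $p_{n-1}=k\,p'_{n-1}$. -}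

module Defs where

open import Data.Nat using (ℕ; zero; suc; _+_; _*_; _≤_; _<_; pred; _%_)
open import Data.Fin using (Fin; toℕ; fromℕ; zero; suc)
open import Data.List using (List; []; _∷_; reverse)
open import Data.Fin.Permutation using (Permutation′; _⟨$⟩ʳ_)
open import Data.Integer using (+_)
open import Data.Rational.Unnormalised using (ℚᵘ; mkℚᵘ; _≃_)
import Data.Rational.Unnormalised as Q
open import Relation.Binary.PropositionalEquality using (_≡_)

-- Continuant of a list given in REVERSED order (last entry first):
-- Krev (x_{m-1} ∷ x_{m-2} ∷ … ∷ x_0 ∷ []) = K_m(x_0,…,x_{m-1}).
Krev : List ℕ → ℕ
Krev []           = 1
Krev (x ∷ [])     = x
Krev (x ∷ y ∷ ys) = x * Krev (y ∷ ys) + Krev ys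

K : List ℕ → ℕ
K xs = Krev (reverse xs)

-- the list (a_i , a_{i+1}, …, a_j) of entries of a digit vector, for i ≤ j
-- given as: segment a i len = (a_i, …, a_{i+len-1}) (entries beyond n are dropped)
segment : ∀ {n} → (Fin (suc n) → ℕ) → ℕ → ℕ → List ℕ
segment {n} a i zero    = []
segment {n} a i (suc l) = go (i Data.Nat.<? suc n)
  where
    open import Relation.Nullary using (yes; no)
    open import Data.Fin using (fromℕ<)
    go : _ → List ℕ
    go (yes i<) = a (fromℕ< i<) ∷ segment a (suc i) l
    go (no _)   = []

p : ∀ {n} → (Fin (suc n) → ℕ) → ℕ → ℕ
p a j = K (segment a 0 (suc j))

q : ∀ {n} → (Fin (suc n) → ℕ) → ℕ → ℕ
q a j = K (segment a 1 j)

-- the value [a_0; a_1, …, a_n] = p_n / q_n  (q_n ≥ 1 for positive digits)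
cf : ∀ {n} → (Fin (suc n) → ℕ) → ℚᵘ
cf {n} a = mkℚᵘ (+ p a n) (pred (q a n))

IsCF : ∀ {n} → (Fin (suc n) → ℕ) → Set
IsCF {zero}  a = (∀ i → 1 ≤ a i)
IsCF {suc n} a = (∀ i → 1 ≤ a i) × (2 ≤ a (fromℕ (suc n)))
  where open import Data.Product using (_×_)

permute : ∀ {n} → Permutation′ (suc n) → (Fin (suc n) → ℕ) → (Fin (suc n) → ℕ)
permute σ a j = a (σ ⟨$⟩ʳ j)

IsPermutiple : ∀ {n} → ℕ → Permutation′ (suc n) → (Fin (suc n) → ℕ) → Set
IsPermutiple k σ a = cf a ≃ (mkℚᵘ (+ k) 0 Q.* cf (permute σ a))

IsPerfect : ∀ {n} → ℕ → Permutation′ (suc n) → (Fin (suc n) → ℕ) → Set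
IsPerfect k σ a =
  ∀ j → (toℕ j % 2 ≡ 0 → a j ≡ k * a (σ ⟨$⟩ʳ j))
      × (toℕ j % 2 ≡ 1 → a (σ ⟨$⟩ʳ j) ≡ k * a j)
  where open import Data.Product using (_×_)

IsContinuantPreserving : ∀ {n} → Permutation′ (suc n) → (Fin (suc n) → ℕ) → Set
IsContinuantPreserving {n} σ a = p a n ≡ p (permute σ a) n

-- index-shifted versions: P m = p_{m-1}, Q m = q_{m-1}, with the standard
-- conventions p_{-1} = 1, q_{-1} = 0 (only relevant for n = 0).
P : ∀ {n} → (Fin (suc n) → ℕ) → ℕ → ℕ
P a zero    = 1
P a (suc j) = p a j

Q′ : ∀ {n} → (Fin (suc n) → ℕ) → ℕ → ℕ
Q′ a zero    = 0
Q′ a (suc j) = q a j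

IsLandess : ∀ {n} → ℕ → Permutation′ (suc n) → (Fin (suc n) → ℕ) → Set
IsLandess {n} k σ a = IsContinuantPreserving σ a
  × (Q′ a n ≡ Q′ (permute σ a) n)
  × (P a n ≡ k * P (permute σ a) n)
  where open import Data.Product using (_×_)

{-# OPTIONS --safe #-}
module Submission where

-- Perfection says that the digit sequences x = (a_i) and y = (a_{σ(i)}) are interlaced:
-- x_i = k y_i at even i and y_i = k x_i at odd i. Feeding this into the recurrence
-- K_{m+2} = x_{m+1} K_{m+1} + K_m shows by induction that the prefix continuants satisfy
-- K_m(x) = K_m(y) for even m and K_m(x) = k K_m(y) for odd m. For odd n this gives p_n = p'_n and
-- p_{n-1} = k p'_{n-1}; the sequences (a_1, a_2, …) and (a_{σ(1)}, a_{σ(2)}, …) are interlaced with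
-- the roles of x and y swapped, which gives q_{n-1} = q'_{n-1}.
-- Even n is impossible: multiplying a_i k^{[i odd]} = a_{σ(i)} k^{[i even]} over all i, the digits
-- cancel because σ is a permutation, leaving k^{n/2} = k^{n/2+1}.

open import Defs
open import Data.Nat using (ℕ; suc; _<_)
open import Data.Fin using (Fin)
open import Data.Fin.Permutation using (Permutation′)

open import Data.Nat using (zero; _+_; _*_; _^_; _%_; _≤_; z<s; _<?_; >-nonZero)
open import Data.Nat.Properties
open import Data.Nat.DivMod using (m*n%n≡0; [m+kn]%n≡m%n)
open import Data.Fin as Fin using (toℕ; fromℕ<)
open import Data.Fin.Properties using (toℕ-fromℕ<; fromℕ<-toℕ; toℕ<n)
open import Data.Fin.Permutation using (_⟨$⟩ʳ_)
open import Data.List using (_∷_; applyUpTo; applyDownFrom)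
open import Data.List.Properties using (reverse-applyUpTo)
open import Data.Product using (_×_; _,_; proj₁; proj₂; ∃-syntax)
open import Data.Sum using (_⊎_; inj₁; inj₂)
open import Function using (_∘_)
open import Relation.Nullary using (¬_; yes; no; contradiction)
open import Relation.Binary.PropositionalEquality
open import Algebra.Properties.CommutativeMonoid.Sum *-1-commutativeMonoid
  using () renaming (sum to ∏; sum-cong-≗ to ∏-cong; ∑-distrib-+ to ∏-distrib-*; sum-permute to ∏-permute)

open ≡-Reasoning

even-or-odd : ∀ n → (∃[ t ] n ≡ t * 2) ⊎ (∃[ t ] n ≡ suc (t * 2))
even-or-odd zero = inj₁ (0 , refl)
even-or-odd (suc zero) = inj₂ (0 , refl)
even-or-odd (suc (suc n)) with even-or-odd n
... | inj₁ (t , refl) = inj₁ (suc t , refl)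
... | inj₂ (t , refl) = inj₂ (suc t , refl)

∏-positive : ∀ {m} (f : Fin m → ℕ) → (∀ j → 0 < f j) → 0 < ∏ f
∏-positive {zero} f pos = ≤-refl
∏-positive {suc m} f pos =
  *-mono-≤ (pos Fin.zero) (∏-positive (f ∘ Fin.suc) (pos ∘ Fin.suc))

∏-cancel-permute : ∀ {m} (σ : Permutation′ m) (f u w : Fin m → ℕ) → (∀ j → 0 < f j) →
  (∀ j → f j * u j ≡ f (σ ⟨$⟩ʳ j) * w j) → ∏ u ≡ ∏ w
∏-cancel-permute σ f u w pos eq =
  *-cancelˡ-≡ (∏ u) (∏ w) (∏ f) {{>-nonZero (∏-positive f pos)}} (begin
    ∏ f * ∏ u                      ≡⟨ ∏-distrib-* f u ⟨
    ∏ (λ j → f j * u j)            ≡⟨ ∏-cong eq ⟩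
    ∏ (λ j → f (σ ⟨$⟩ʳ j) * w j)   ≡⟨ ∏-distrib-* (f ∘ (σ ⟨$⟩ʳ_)) w ⟩
    ∏ (f ∘ (σ ⟨$⟩ʳ_)) * ∏ w        ≡⟨ cong (_* ∏ w) (∏-permute f σ) ⟨
    ∏ f * ∏ w                      ∎)

alternating : ℕ → ℕ → ℕ
alternating k zero = 1
alternating k (suc zero) = k
alternating k (suc (suc i)) = alternating k i

∏-alternating : ∀ k t → ∏ {suc (t * 2)} (λ j → alternating k (toℕ j)) ≡ k ^ t
∏-alternating k zero = refl
∏-alternating k (suc t) = trans (*-identityˡ _) (cong (k *_) (∏-alternating k t))

∏-alternating-suc : ∀ k t → ∏ {suc (t * 2)} (λ j → alternating k (suc (toℕ j))) ≡ k ^ suc t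
∏-alternating-suc k zero = refl
∏-alternating-suc k (suc t) = cong (k *_) (trans (*-identityˡ _) (∏-alternating-suc k t))

record Interlaced (k : ℕ) (x y : ℕ → ℕ) : Set where
  field
    even-scaled : ∀ t → x (t * 2) ≡ k * y (t * 2)
    odd-scaled  : ∀ t → y (suc (t * 2)) ≡ k * x (suc (t * 2))

open Interlaced

interlaced-shift : ∀ {k x y} → Interlaced k x y → Interlaced k (y ∘ suc) (x ∘ suc)
interlaced-shift x≈y = record
  { even-scaled = odd-scaled x≈y
  ; odd-scaled  = even-scaled x≈y ∘ suc
  }

interlaced-drop₂ : ∀ {k x y} → Interlaced k x y → Interlaced k (x ∘ suc ∘ suc) (y ∘ suc ∘ suc)
interlaced-drop₂ x≈y = record
  { even-scaled = even-scaled x≈y ∘ suc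
  ; odd-scaled  = odd-scaled x≈y ∘ suc
  }

interlaced-weights : ∀ {k x y} → Interlaced k x y →
  ∀ i → x i * alternating k i ≡ y i * alternating k (suc i)
interlaced-weights {k} x≈y zero =
  trans (*-identityʳ _) (trans (even-scaled x≈y 0) (*-comm k _))
interlaced-weights {k} x≈y (suc zero) =
  trans (*-comm _ k) (sym (trans (*-identityʳ _) (odd-scaled x≈y 0)))
interlaced-weights x≈y (suc (suc i)) = interlaced-weights (interlaced-drop₂ x≈y) i

-- K_m(f 0, …, f (m - 1)), unfolded from the last entry so that the recurrence holds by definition
continuant : (ℕ → ℕ) → ℕ → ℕ
continuant f m = Krev (applyDownFrom f m)

K-applyUpTo : ∀ f m → K (applyUpTo f m) ≡ continuant f m
K-applyUpTo f m = cong Krev (reverse-applyUpTo f m)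

interlaced-continuant : ∀ {k x y} → Interlaced k x y → ∀ t →
  continuant x (t * 2) ≡ continuant y (t * 2) ×
  continuant x (suc (t * 2)) ≡ k * continuant y (suc (t * 2))
interlaced-continuant x≈y zero = refl , even-scaled x≈y 0
interlaced-continuant {k} {x} {y} x≈y (suc t) = even , odd
  where
  m = t * 2
  IH : continuant x m ≡ continuant y m × continuant x (suc m) ≡ k * continuant y (suc m)
  IH = interlaced-continuant x≈y t
  even : continuant x (suc (suc m)) ≡ continuant y (suc (suc m))
  even = begin
    x (suc m) * continuant x (suc m) + continuant x m
      ≡⟨ cong₂ (λ u v → x (suc m) * u + v) (proj₂ IH) (proj₁ IH) ⟩
    x (suc m) * (k * continuant y (suc m)) + continuant y m
      ≡⟨ cong (_+ continuant y m) (*-assoc (x (suc m)) k _) ⟨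
    x (suc m) * k * continuant y (suc m) + continuant y m
      ≡⟨ cong (λ u → u * continuant y (suc m) + continuant y m) (*-comm (x (suc m)) k) ⟩
    k * x (suc m) * continuant y (suc m) + continuant y m
      ≡⟨ cong (λ u → u * continuant y (suc m) + continuant y m) (odd-scaled x≈y t) ⟨
    y (suc m) * continuant y (suc m) + continuant y m
      ∎
  odd : continuant x (suc (suc (suc m))) ≡ k * continuant y (suc (suc (suc m)))
  odd = begin
    x (suc (suc m)) * continuant x (suc (suc m)) + continuant x (suc m)
      ≡⟨ cong₂ (λ u v → u * continuant x (suc (suc m)) + v) (even-scaled x≈y (suc t)) (proj₂ IH) ⟩
    k * y (suc (suc m)) * continuant x (suc (suc m)) + k * continuant y (suc m)
      ≡⟨ cong (λ u → k * y (suc (suc m)) * u + k * continuant y (suc m)) even ⟩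
    k * y (suc (suc m)) * continuant y (suc (suc m)) + k * continuant y (suc m)
      ≡⟨ cong (_+ k * continuant y (suc m)) (*-assoc k _ _) ⟩
    k * (y (suc (suc m)) * continuant y (suc (suc m))) + k * continuant y (suc m)
      ≡⟨ *-distribˡ-+ k _ _ ⟨
    k * continuant y (suc (suc (suc m)))
      ∎

-- a_i, and 0 for i > n
digit : ∀ {n} → (Fin (suc n) → ℕ) → ℕ → ℕ
digit {n} a i with i <? suc n
... | yes i<1+n = a (fromℕ< i<1+n)
... | no _ = 0

digit-toℕ : ∀ {n} (a : Fin (suc n) → ℕ) j → digit a (toℕ j) ≡ a j
digit-toℕ {n} a j with toℕ j <? suc n
... | yes j<1+n = cong a (fromℕ<-toℕ j j<1+n)
... | no j≮1+n = contradiction (toℕ<n j) j≮1+n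

segment-suc : ∀ {n} (a : Fin (suc n) → ℕ) {i} l → i < suc n →
  segment a i (suc l) ≡ digit a i ∷ segment a (suc i) l
segment-suc {n} a {i} l i<1+n with i <? suc n
... | yes _ = refl
... | no i≮1+n = contradiction i<1+n i≮1+n

applyUpTo-cong : ∀ {f g : ℕ → ℕ} → (∀ m → f m ≡ g m) → ∀ l → applyUpTo f l ≡ applyUpTo g l
applyUpTo-cong f≗g zero = refl
applyUpTo-cong f≗g (suc l) = cong₂ _∷_ (f≗g 0) (applyUpTo-cong (f≗g ∘ suc) l)

segment≡applyUpTo : ∀ {n} (a : Fin (suc n) → ℕ) i l → i + l ≤ suc n →
  segment a i l ≡ applyUpTo (λ m → digit a (i + m)) l
segment≡applyUpTo a i zero _ = refl
segment≡applyUpTo {n} a i (suc l) i+l<1+n = begin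
  segment a i (suc l)
    ≡⟨ segment-suc a l (<-≤-trans (m<m+n i z<s) i+l<1+n) ⟩
  digit a i ∷ segment a (suc i) l
    ≡⟨ cong₂ _∷_ (cong (digit a) (sym (+-identityʳ i)))
                 (segment≡applyUpTo a (suc i) l (subst (_≤ suc n) (+-suc i l) i+l<1+n)) ⟩
  digit a (i + 0) ∷ applyUpTo (λ m → digit a (suc i + m)) l
    ≡⟨ cong (_ ∷_) (applyUpTo-cong (λ m → cong (digit a) (+-suc i m)) l) ⟨
  applyUpTo (λ m → digit a (i + m)) (suc l)
    ∎

p≡continuant : ∀ {n} (a : Fin (suc n) → ℕ) j → j < suc n → p a j ≡ continuant (digit a) (suc j)
p≡continuant a j j<1+n =
  trans (cong K (segment≡applyUpTo a 0 (suc j) j<1+n)) (K-applyUpTo (digit a) (suc j))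

q≡continuant : ∀ {n} (a : Fin (suc n) → ℕ) j → j < suc n → q a j ≡ continuant (digit a ∘ suc) j
q≡continuant a j j<1+n =
  trans (cong K (segment≡applyUpTo a 1 j j<1+n)) (K-applyUpTo (digit a ∘ suc) j)

perfect-digit : ∀ {n} k (σ : Permutation′ (suc n)) a → IsPerfect k σ a → ∀ i →
  (i % 2 ≡ 0 → digit a i ≡ k * digit (permute σ a) i) ×
  (i % 2 ≡ 1 → digit (permute σ a) i ≡ k * digit a i)
perfect-digit {n} k σ a perf i with i <? suc n
... | yes i<1+n = proj₁ (perf j) ∘ trans j%2≡i%2 , proj₂ (perf j) ∘ trans j%2≡i%2
  where
  j = fromℕ< i<1+n
  j%2≡i%2 : toℕ j % 2 ≡ i % 2
  j%2≡i%2 = cong (_% 2) (toℕ-fromℕ< i<1+n)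
... | no _ = (λ _ → sym (*-zeroʳ k)) , (λ _ → sym (*-zeroʳ k))

perfect⇒interlaced : ∀ {n} k (σ : Permutation′ (suc n)) a → IsPerfect k σ a →
  Interlaced k (digit a) (digit (permute σ a))
perfect⇒interlaced k σ a perf = record
  { even-scaled = λ t → proj₁ (perfect-digit k σ a perf (t * 2)) (m*n%n≡0 t 2)
  ; odd-scaled  = λ t → proj₂ (perfect-digit k σ a perf (suc (t * 2))) ([m+kn]%n≡m%n 1 t 2)
  }

IsCF⇒positive : ∀ {n} (a : Fin (suc n) → ℕ) → IsCF a → ∀ i → 0 < a i
IsCF⇒positive {zero} a cf = cf
IsCF⇒positive {suc n} a cf = proj₁ cf

odd-length-not-perfect : ∀ k t → 1 < k → (σ : Permutation′ (suc (t * 2))) (a : Fin (suc (t * 2)) → ℕ) →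
  IsCF a → ¬ IsPerfect k σ a
odd-length-not-perfect k t 1<k σ a cf perf =
  <-irrefl k^t≡k^[1+t] (^-monoʳ-< k 1<k (n<1+n t))
  where
  u w : Fin (suc (t * 2)) → ℕ
  u j = alternating k (toℕ j)
  w j = alternating k (suc (toℕ j))
  weights : ∀ j → a j * u j ≡ a (σ ⟨$⟩ʳ j) * w j
  weights j = subst₂ (λ aⱼ aσⱼ → aⱼ * u j ≡ aσⱼ * w j) (digit-toℕ a j) (digit-toℕ (permute σ a) j)
    (interlaced-weights (perfect⇒interlaced k σ a perf) (toℕ j))
  k^t≡k^[1+t] : k ^ t ≡ k ^ suc t
  k^t≡k^[1+t] = begin
    k ^ t      ≡⟨ ∏-alternating k t ⟨
    ∏ u        ≡⟨ ∏-cancel-permute σ a u w (IsCF⇒positive a cf) weights ⟩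
    ∏ w        ≡⟨ ∏-alternating-suc k t ⟩
    k ^ suc t  ∎

even-length-perfect⇒landess : ∀ k t (σ : Permutation′ (suc (suc (t * 2)))) (a : Fin (suc (suc (t * 2))) → ℕ) →
  IsPerfect k σ a → IsLandess k σ a
even-length-perfect⇒landess k t σ a perf = p-preserved , q-preserved , p-scaled
  where
  b = permute σ a
  m = t * 2
  a≈b : Interlaced k (digit a) (digit b)
  a≈b = perfect⇒interlaced k σ a perf
  m<2+m : m < suc (suc m)
  m<2+m = m<n+m m z<s
  p-preserved : p a (suc m) ≡ p b (suc m)
  p-preserved = begin
    p a (suc m)                      ≡⟨ p≡continuant a (suc m) ≤-refl ⟩
    continuant (digit a) (suc t * 2) ≡⟨ proj₁ (interlaced-continuant a≈b (suc t)) ⟩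
    continuant (digit b) (suc t * 2) ≡⟨ p≡continuant b (suc m) ≤-refl ⟨
    p b (suc m)                      ∎
  q-preserved : q a m ≡ q b m
  q-preserved = begin
    q a m                        ≡⟨ q≡continuant a m m<2+m ⟩
    continuant (digit a ∘ suc) m ≡⟨ proj₁ (interlaced-continuant (interlaced-shift a≈b) t) ⟨
    continuant (digit b ∘ suc) m ≡⟨ q≡continuant b m m<2+m ⟨
    q b m                        ∎
  p-scaled : p a m ≡ k * p b m
  p-scaled = begin
    p a m                            ≡⟨ p≡continuant a m m<2+m ⟩
    continuant (digit a) (suc m)     ≡⟨ proj₂ (interlaced-continuant a≈b t) ⟩
    k * continuant (digit b) (suc m) ≡⟨ cong (k *_) (p≡continuant b m m<2+m) ⟨
    k * p b m                        ∎

theorem26 : (n k : ℕ) → 1 < k → (σ : Permutation′ (suc n)) → (a : Fin (suc n) → ℕ)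
    → IsCF a → IsPermutiple k σ a → IsPerfect k σ a → IsLandess k σ a
theorem26 n k 1<k σ a cf _ perf with even-or-odd n
... | inj₁ (t , refl) = contradiction perf (odd-length-not-perfect k t 1<k σ a cf)
... | inj₂ (t , refl) = even-length-perfect⇒landess k t σ a perf
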